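{- Let $\tau$ be a permutation and let $L(\tau)=\lim_{n\to\infty}|S_n(\tau)|^{1/n}$ be its Stanley--Wilf limit. Then \[\limsup_{n\to\infty}|\widetilde{S}^{/\!/}_n(\tau)|^{1/n}\le 3L(\tau).\]
   Context: $S_n$ is the set of permutations of $[n]=\{1,\dots,n\}$, and $S_n(\tau)$ is the set of those that avoid $\tau$. A permutation $\pi$ contains $\tau\in S_k$ if some subsequence $\pi(i_1),\dots,\pi(i_k)$ with $i_1<\dots<i_k$ is order-isomorphic to $\tau(1),\dots,\tau(k)$; otherwise $\pi$ avoids $\tau$. The limit $L(\tau)$ exists and is finite. An affine permutation of size $n$ is a bijection $\sigma:\mathbb{Z}\to\mathbb{Z}$ such that $\sigma(i+n)=\sigma(i)+n$ for all $i$ and $\sum_{i=1}^n\sigma(i)=\sum_{i=1}^n i$. It is bounded if $|\sigma(i)-i|<n$ for all $i$. An affine permutation contains $\tau\in S_k$ if there are integers $i_1<\dots<i_k$ with $\sigma(i_1),\dots,\sigma(i_k)$ order-isomorphic to $\tau$. $\widetilde{S}^{/\!/}_n(\tau)$ denotes the set of bounded affine permutations of size $n$ that avoid $\tau$. -}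

module Defs where

open import Data.Nat as ℕ using (ℕ; zero; suc; _≤_; _*_; _^_)
open import Data.Integer as ℤ using (ℤ; +_; ∣_∣)
open import Data.Fin using (Fin; toℕ)
open import Data.Fin.Permutation using (Permutation′; _⟨$⟩ʳ_)
open import Data.Product using (Σ; ∃; _×_)
open import Data.List using (List; length)
open import Data.List.Relation.Unary.All using (All)
open import Data.List.Relation.Unary.AllPairs using (AllPairs)
open import Function.Bundles using (_⇔_)
open import Function.Definitions using (Bijective)
open import Relation.Binary.PropositionalEquality using (_≡_)
open import Relation.Nullary using (¬_)

Contains : ∀ {n k} → Permutation′ n → Permutation′ k → Set
Contains {n} {k} π τ =
  Σ (Fin k → Fin n) λ idx →
    (∀ a b → toℕ a ℕ.< toℕ b → toℕ (idx a) ℕ.< toℕ (idx b)) ×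
    (∀ a b → (toℕ (π ⟨$⟩ʳ idx a) ℕ.< toℕ (π ⟨$⟩ʳ idx b)) ⇔ (toℕ (τ ⟨$⟩ʳ a) ℕ.< toℕ (τ ⟨$⟩ʳ b)))

Avoids : ∀ {n k} → Permutation′ n → Permutation′ k → Set
Avoids π τ = ¬ Contains π τ

sumTo : (ℤ → ℤ) → ℕ → ℤ
sumTo σ zero = + 0
sumTo σ (suc m) = sumTo σ m ℤ.+ σ (+ suc m)

record IsAffinePerm (n : ℕ) (σ : ℤ → ℤ) : Set where
  field
    bij      : Bijective _≡_ _≡_ σ
    periodic : ∀ i → σ (i ℤ.+ + n) ≡ σ i ℤ.+ + n
    sumCond  : sumTo σ n ≡ sumTo (λ i → i) n

IsBounded : ℕ → (ℤ → ℤ) → Set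
IsBounded n σ = ∀ i → ∣ σ i ℤ.- i ∣ ℕ.< n

AffContains : ∀ {k} → (ℤ → ℤ) → Permutation′ k → Set
AffContains {k} σ τ =
  Σ (Fin k → ℤ) λ idx →
    (∀ a b → toℕ a ℕ.< toℕ b → idx a ℤ.< idx b) ×
    (∀ a b → (σ (idx a) ℤ.< σ (idx b)) ⇔ (toℕ (τ ⟨$⟩ʳ a) ℕ.< toℕ (τ ⟨$⟩ʳ b)))

BddAffAvoider : ∀ {k} → ℕ → Permutation′ k → (ℤ → ℤ) → Set
BddAffAvoider n τ σ = IsAffinePerm n σ × IsBounded n σ × ¬ AffContains σ τ

-- Cardinality upper bounds "|A| ≤ m", phrased as: every duplicate-free list
-- of elements of A has length ≤ m (distinctness = not pointwise equal).
-- We use the scaled form  |A| * q ≤ p  (i.e. |A| ≤ p / q).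
CardS≤ : ∀ {k} (n : ℕ) → Permutation′ k → (q p : ℕ) → Set
CardS≤ n τ q p =
  (xs : List (Permutation′ n)) →
  All (λ π → Avoids π τ) xs →
  AllPairs (λ π ρ → ¬ (∀ i → π ⟨$⟩ʳ i ≡ ρ ⟨$⟩ʳ i)) xs →
  length xs * q ≤ p

CardAff≤ : ∀ {k} (n : ℕ) → Permutation′ k → (q p : ℕ) → Set
CardAff≤ n τ q p =
  (xs : List (ℤ → ℤ)) →
  All (BddAffAvoider n τ) xs →
  AllPairs (λ σ ρ → ¬ (∀ i → σ i ≡ ρ i)) xs →
  length xs * q ≤ p

-- "Eventually |S_n(τ)| ≤ (p/q)^n"  (witnesses L(τ) ≤ p/q)
EventuallyS≤ : ∀ {k} → Permutation′ k → ℕ → ℕ → Set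
EventuallyS≤ τ p q = ∃ λ N → ∀ n → N ≤ n → CardS≤ n τ (q ^ n) (p ^ n)

EventuallyAff≤ : ∀ {k} → Permutation′ k → ℕ → ℕ → Set
EventuallyAff≤ τ r s = ∃ λ N → ∀ n → N ≤ n → CardAff≤ n τ (s ^ n) (r ^ n)

{-# OPTIONS --safe #-}

-- Let σ be a bounded affine permutation of size n. Its window values σ(0), …, σ(n-1), shifted
-- by n, lie in [0, 3n), and by periodicity and injectivity of σ they are pairwise incongruent
-- mod n. So each residue class r mod n contains exactly one of them, in one of the three
-- blocks [0, n), [n, 2n), [2n, 3n); recording that block for every r gives a code in {0,1,2}ⁿ
-- which fixes the set of window values. That set together with the relative order of the
-- window values (a permutation of [n] that avoids τ whenever σ does) fixes the window, and by
-- periodicity σ itself. Hence |S̃ₙ(τ)| ≤ 3ⁿ |Sₙ(τ)|, and 3 p / q < r / s turns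
-- |Sₙ(τ)| ≤ (p / q)ⁿ into |S̃ₙ(τ)| ≤ (r / s)ⁿ.
module Submission where

open import Defs
open import Data.Nat using (ℕ; _*_; _<_; _≤_)
open import Data.Fin.Permutation using (Permutation′)

open import Data.Fin as Fin using (Fin; toℕ)
import Data.Fin.Properties as Fin
open import Data.Fin.Permutation using (permutation; _⟨$⟩ʳ_; _⟨$⟩ˡ_; inverseˡ; inverseʳ; _≈_)
open import Data.Integer as ℤ using (ℤ; +_; -[1+_]; ∣_∣)
import Data.Integer.DivMod as ℤ
import Data.Integer.Properties as ℤ
open import Algebra.Properties.AbelianGroup ℤ.+-0-abelianGroup using (∙-cancelʳ)
open import Data.Integer.Tactic.RingSolver renaming (solve-∀ to ℤ-solve-∀)
open import Data.List using (List; []; _∷_; length; filter; allFin)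
open import Data.List.Membership.Propositional using (_∈_)
open import Data.List.Membership.Propositional.Properties using (∈-allFin)
open import Data.List.Properties using (length-tabulate)
open import Data.List.Relation.Unary.All as All using (All; []; _∷_; reduce)
import Data.List.Relation.Unary.All.Properties as All
open import Data.List.Relation.Unary.AllPairs as AllPairs using (AllPairs; []; _∷_)
import Data.List.Relation.Unary.AllPairs.Properties as AllPairs
open import Data.List.Relation.Unary.Any using (here; there)
open import Data.Nat using (zero; suc; _+_; _^_; z≤n; s≤s; NonZero; >-nonZero)
open import Data.Nat.Induction using (<-wellFounded)
import Data.Nat.Properties as ℕ
open import Data.Nat.Tactic.RingSolver renaming (solve-∀ to ℕ-solve-∀)
open import Data.Product using (∃; _×_; _,_; proj₁; proj₂)
open import Data.Product.Relation.Binary.Pointwise.NonDependent using (Pointwise)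
open import Data.Unit using (tt)
open import Function using (id; _∘_)
open import Function.Bundles using (_⇔_; mk⇔; Equivalence)
open import Function.Definitions using (Injective)
import Function.Properties.Equivalence as ⇔
import Induction.WellFounded as WF
open import Level using (0ℓ)
open import Relation.Binary using (Rel; DecidableEquality; tri<; tri≈; tri>)
import Relation.Binary.Construct.On as On
open import Relation.Binary.PropositionalEquality
open import Relation.Nullary using (¬_; yes; no; contradiction)
open import Relation.Unary using (Pred; Decidable; Empty; _⊆_; _∩_; ∁)
open import Relation.Unary.Properties using (∁?; U?)

CardBound : {A : Set} → Pred A 0ℓ → Rel A 0ℓ → ℕ → ℕ → Set
CardBound P _∼_ q p =
  ∀ xs → All P xs → AllPairs (λ x y → ¬ x ∼ y) xs → length xs * q ≤ p

private variable
  A B K : Set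
  P Q : Pred A 0ℓ
  _∼_ : Rel A 0ℓ
  a b c p q : ℕ

empty⇒CardBound : Empty P → CardBound P _∼_ q p
empty⇒CardBound ∅ []      _       _ = z≤n
empty⇒CardBound ∅ (x ∷ _) (px ∷ _) _ = contradiction px (∅ x)

CardBound-⊆ : P ⊆ Q → CardBound Q _∼_ q p → CardBound P _∼_ q p
CardBound-⊆ P⊆Q bound xs pxs = bound xs (All.map P⊆Q pxs)

module _ (Q? : Decidable Q) where

  length-filter+length-filter∁ : ∀ xs → length (filter Q? xs) + length (filter (∁? Q?) xs) ≡ length xs
  length-filter+length-filter∁ [] = refl
  length-filter+length-filter∁ (x ∷ xs) with Q? x
  ... | yes _ = cong suc (length-filter+length-filter∁ xs)
  ... | no _  = trans (ℕ.+-suc _ _) (cong suc (length-filter+length-filter∁ xs))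

  CardBound-∪ : CardBound (P ∩ Q) _∼_ q a → CardBound (P ∩ ∁ Q) _∼_ q b → CardBound P _∼_ q (a + b)
  CardBound-∪ {P = P} {_∼_ = _∼_} {q = q} {a = a} {b = b} boundQ bound∁Q xs pxs distinct = begin
    length xs * q
      ≡⟨ cong (_* q) (length-filter+length-filter∁ xs) ⟨
    (length (filter Q? xs) + length (filter (∁? Q?) xs)) * q
      ≡⟨ ℕ.*-distribʳ-+ q (length (filter Q? xs)) _ ⟩
    length (filter Q? xs) * q + length (filter (∁? Q?) xs) * q
      ≤⟨ ℕ.+-mono-≤ (restrict Q? boundQ) (restrict (∁? Q?) bound∁Q) ⟩
    a + b
      ∎
    where
    open ℕ.≤-Reasoning
    restrict : ∀ {R : Pred _ 0ℓ} {c} (R? : Decidable R) → CardBound (P ∩ R) _∼_ q c →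
               length (filter R? xs) * q ≤ c
    restrict R? bound = bound (filter R? xs) (All.zip (All.filter⁺ R? pxs , All.all-filter R? xs))
                              (AllPairs.filter⁺ R? distinct)

CardBound-fibres : (key : A → K) → DecidableEquality K → (ks : List K) →
                   (∀ k → CardBound (P ∩ (λ x → key x ≡ k)) _∼_ q p) →
                   CardBound (P ∩ (λ x → key x ∈ ks)) _∼_ q (length ks * p)
CardBound-fibres key _≟_ []       _     = empty⇒CardBound λ _ ()
CardBound-fibres key _≟_ (k ∷ ks) fibre = CardBound-∪ (λ x → key x ≟ k)
  (CardBound-⊆ (λ ((px , _) , x∈k) → px , x∈k) (fibre k))
  (CardBound-⊆ (λ { ((px , here x≡k) , x≢k) → contradiction x≡k x≢k
                  ; ((px , there x∈ks) , _) → px , x∈ks })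
               (CardBound-fibres key _≟_ ks fibre))

module _ {P′ : Pred B 0ℓ} {_∼′_ : Rel B 0ℓ}
         (f : ∀ {x} → P x → B) (f-P′ : ∀ {x} (px : P x) → P′ (f px))
         (f-reflects : ∀ {x y} (px : P x) (py : P y) → f px ∼′ f py → x ∼ y) where

  CardBound-map : CardBound P′ _∼′_ q p → CardBound P _∼_ q p
  CardBound-map {q = q} {p = p} bound xs pxs distinct =
    subst (λ l → l * q ≤ p) (length-reduce pxs)
      (bound (reduce f pxs) (all-reduce pxs) (distinct-reduce pxs distinct))
    where
    length-reduce : ∀ {xs} (pxs : All P xs) → length (reduce f pxs) ≡ length xs
    length-reduce []        = refl
    length-reduce (_ ∷ pxs) = cong suc (length-reduce pxs)
    all-reduce : ∀ {xs} (pxs : All P xs) → All P′ (reduce f pxs)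
    all-reduce []         = []
    all-reduce (px ∷ pxs) = f-P′ px ∷ all-reduce pxs
    apart-reduce : ∀ {x xs} (px : P x) (pxs : All P xs) → All (λ y → ¬ x ∼ y) xs →
                   All (λ b → ¬ f px ∼′ b) (reduce f pxs)
    apart-reduce px []         []            = []
    apart-reduce px (py ∷ pys) (x≁y ∷ apart) =
      (λ fx∼fy → x≁y (f-reflects px py fx∼fy)) ∷ apart-reduce px pys apart
    distinct-reduce : ∀ {xs} (pxs : All P xs) → AllPairs (λ x y → ¬ x ∼ y) xs →
                      AllPairs (λ a b → ¬ a ∼′ b) (reduce f pxs)
    distinct-reduce []         []                 = []
    distinct-reduce (px ∷ pxs) (apart ∷ distinct) = apart-reduce px pxs apart ∷ distinct-reduce pxs distinct

CardBound-× : CardBound P _∼_ q p → CardBound {A × Fin c} (λ (x , _) → P x) (Pointwise _∼_ _≡_) q (c * p)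
CardBound-× {P = P} {_∼_ = _∼_} {q = q} {p = p} {c = c} bound =
  subst (CardBound _ _ q) (cong (_* p) (length-tabulate {n = c} id))
    (CardBound-⊆ (λ px → px , ∈-allFin _) (CardBound-fibres proj₂ Fin._≟_ (allFin c) fibre))
  where
  fibre : ∀ t → CardBound (λ (x , s) → P x × s ≡ t) (Pointwise _∼_ _≡_) q p
  fibre t = CardBound-map (λ {(x , _)} _ → x) proj₁
    (λ (_ , s≡t) (_ , s′≡t) x∼y → x∼y , trans s≡t (sym s′≡t)) bound

injective⇒surjective : ∀ {n} {f : Fin n → Fin n} → Injective _≡_ _≡_ f → ∀ y → ∃ λ x → f x ≡ y
injective⇒surjective {suc n} {f} f-injective y with Fin.any? (λ x → f x Fin.≟ y)
... | yes hit  = hit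
... | no  miss = contradiction (Fin.injective⇒≤ {f = squeeze} squeeze-injective) ℕ.1+n≰n
  where
  y≢f : ∀ x → y ≢ f x
  y≢f x y≡fx = miss (x , sym y≡fx)
  squeeze : Fin (suc n) → Fin n
  squeeze x = Fin.punchOut (y≢f x)
  squeeze-injective : Injective _≡_ _≡_ squeeze
  squeeze-injective eq = f-injective (Fin.punchOut-injective (y≢f _) (y≢f _) eq)

injective⇒permutation : ∀ {n} (f : Fin n → Fin n) → Injective _≡_ _≡_ f → Permutation′ n
injective⇒permutation f f-injective = permutation f (proj₁ ∘ surj) (proj₂ ∘ surj)
  (λ x → f-injective (proj₂ (surj (f x))))
  where
  surj : ∀ y → ∃ λ x → f x ≡ y
  surj = injective⇒surjective f-injective

count : ∀ {n} {P : Pred (Fin n) 0ℓ} → Decidable P → ℕ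
count {zero}  _  = 0
count {suc n} P? with P? Fin.zero
... | yes _ = suc (count (P? ∘ Fin.suc))
... | no  _ = count (P? ∘ Fin.suc)

count-mono : ∀ {n} {P Q : Pred (Fin n) 0ℓ} (P? : Decidable P) (Q? : Decidable Q) → P ⊆ Q →
             count P? ≤ count Q?
count-mono {zero}  _  _  _   = z≤n
count-mono {suc n} P? Q? P⊆Q with P? Fin.zero | Q? Fin.zero
... | yes _ | yes _ = s≤s (count-mono (P? ∘ Fin.suc) (Q? ∘ Fin.suc) P⊆Q)
... | yes p | no ¬q = contradiction (P⊆Q p) ¬q
... | no _  | yes _ = ℕ.m≤n⇒m≤1+n (count-mono (P? ∘ Fin.suc) (Q? ∘ Fin.suc) P⊆Q)
... | no _  | no _  = count-mono (P? ∘ Fin.suc) (Q? ∘ Fin.suc) P⊆Q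

count-strict : ∀ {n} {P Q : Pred (Fin n) 0ℓ} (P? : Decidable P) (Q? : Decidable Q) → P ⊆ Q →
               ∀ {i} → Q i → ¬ P i → count P? < count Q?
count-strict {suc n} P? Q? P⊆Q {i} qi ¬pi with P? Fin.zero | Q? Fin.zero | i
... | yes p | no ¬q | _ = contradiction (P⊆Q p) ¬q
... | yes p | yes _ | Fin.zero  = contradiction p ¬pi
... | yes _ | yes _ | Fin.suc i = s≤s (count-strict (P? ∘ Fin.suc) (Q? ∘ Fin.suc) P⊆Q qi ¬pi)
... | no _  | yes _ | _ = s≤s (count-mono (P? ∘ Fin.suc) (Q? ∘ Fin.suc) P⊆Q)
... | no _  | no ¬q | Fin.zero  = contradiction qi ¬q
... | no _  | no _  | Fin.suc i = count-strict (P? ∘ Fin.suc) (Q? ∘ Fin.suc) P⊆Q qi ¬pi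

count-U : ∀ {n} → count (U? {A = Fin n}) ≡ n
count-U {zero}  = refl
count-U {suc n} = cong suc count-U

count<n : ∀ {n} {P : Pred (Fin n) 0ℓ} (P? : Decidable P) {i} → ¬ P i → count P? < n
count<n P? ¬pi = ℕ.<-≤-trans (count-strict P? U? (λ _ → tt) tt ¬pi) (ℕ.≤-reflexive count-U)

module Standardisation {n} (f : Fin n → ℤ) where

  rank : Fin n → ℕ
  rank i = count (λ j → f j ℤ.<? f i)

  rank<n : ∀ i → rank i < n
  rank<n i = count<n _ (ℤ.<-irrefl refl)

  rank-mono : ∀ {i j} → f i ℤ.< f j → rank i < rank j
  rank-mono {i} fi<fj = count-strict _ _ (λ fk<fi → ℤ.<-trans fk<fi fi<fj) {i} fi<fj (ℤ.<-irrefl refl)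

  module _ (f-injective : Injective _≡_ _≡_ f) where

    rank-cancel : ∀ {i j} → rank i < rank j → f i ℤ.< f j
    rank-cancel {i} {j} ri<rj with ℤ.<-cmp (f i) (f j)
    ... | tri< fi<fj _ _ = fi<fj
    ... | tri≈ _ fi≡fj _ = contradiction ri<rj (subst (λ k → ¬ rank i < rank k) (f-injective fi≡fj) (ℕ.<-irrefl refl))
    ... | tri> _ _ fj<fi = contradiction (rank-mono fj<fi) (ℕ.<-asym ri<rj)

    rank-injective : Injective _≡_ _≡_ rank
    rank-injective {i} {j} ri≡rj with ℤ.<-cmp (f i) (f j)
    ... | tri< fi<fj _ _ = contradiction ri≡rj (ℕ.<⇒≢ (rank-mono fi<fj))
    ... | tri≈ _ fi≡fj _ = f-injective fi≡fj
    ... | tri> _ _ fj<fi = contradiction (sym ri≡rj) (ℕ.<⇒≢ (rank-mono fj<fi))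

    standardise : Permutation′ n
    standardise = injective⇒permutation (λ i → Fin.fromℕ< (rank<n i))
      (λ eq → rank-injective (Fin.fromℕ<-injective _ _ (rank<n _) (rank<n _) eq))

    standardise-<⇔ : ∀ i j → toℕ (standardise ⟨$⟩ʳ i) < toℕ (standardise ⟨$⟩ʳ j) ⇔ f i ℤ.< f j
    standardise-<⇔ i j rewrite Fin.toℕ-fromℕ< (rank<n i) | Fin.toℕ-fromℕ< (rank<n j) =
      mk⇔ rank-cancel rank-mono

module _ {n} {f g : Fin n → ℤ} where
  open Standardisation f using (rank; rank-mono)

  -- If f i < g i, then f i = g j for some j with g j < g i, hence f j < f i = g j:
  -- the same situation at an index of smaller rank.
  image-pattern⇒≮ : (∀ {i j} → g i ℤ.< g j → f i ℤ.< f j) → (∀ i → ∃ λ j → f i ≡ g j) →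
                    ∀ i → ¬ f i ℤ.< g i
  image-pattern⇒≮ g<⇒f< f⊆g = WF.All.wfRec (On.wellFounded rank <-wellFounded) 0ℓ _ descend
    where
    descend : ∀ i → (∀ {j} → rank j < rank i → ¬ f j ℤ.< g j) → ¬ f i ℤ.< g i
    descend i smaller fi<gi =
      let (j , fi≡gj) = f⊆g i
          fj<fi = g<⇒f< (subst (ℤ._< g i) fi≡gj fi<gi)
      in smaller (rank-mono fj<fi) (subst (f j ℤ.<_) fi≡gj fj<fi)

same-image-pattern⇒≗ : ∀ {n} {f g : Fin n → ℤ} → (∀ i j → f i ℤ.< f j ⇔ g i ℤ.< g j) →
                       (∀ i → ∃ λ j → f i ≡ g j) → (∀ i → ∃ λ j → g i ≡ f j) → f ≗ g
same-image-pattern⇒≗ {f = f} {g} same-pattern f⊆g g⊆f i with ℤ.<-cmp (f i) (g i)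
... | tri< fi<gi _ _ = contradiction fi<gi (image-pattern⇒≮ (Equivalence.from (same-pattern _ _)) f⊆g i)
... | tri≈ _ fi≡gi _ = fi≡gi
... | tri> _ _ gi<fi = contradiction gi<fi (image-pattern⇒≮ (Equivalence.to (same-pattern _ _)) g⊆f i)

Periodic : ℕ → (ℤ → ℤ) → Set
Periodic n f = ∀ i → f (i ℤ.+ + n) ≡ f i ℤ.+ + n

module _ {n : ℕ} {f : ℤ → ℤ} (periodic : Periodic n f) where

  periodic-+* : ∀ x k → f (x ℤ.+ + k ℤ.* + n) ≡ f x ℤ.+ + k ℤ.* + n
  periodic-+* x zero    = trans (cong f (ℤ.+-identityʳ x)) (sym (ℤ.+-identityʳ (f x)))
  -- + 1 ℤ.+ + k computes to + suc k.
  periodic-+* x (suc k) = begin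
    f (x ℤ.+ (+ 1 ℤ.+ + k) ℤ.* + n)    ≡⟨ cong f (step x (+ k) (+ n)) ⟩
    f ((x ℤ.+ + k ℤ.* + n) ℤ.+ + n)    ≡⟨ periodic _ ⟩
    f (x ℤ.+ + k ℤ.* + n) ℤ.+ + n      ≡⟨ cong (ℤ._+ + n) (periodic-+* x k) ⟩
    (f x ℤ.+ + k ℤ.* + n) ℤ.+ + n      ≡⟨ step (f x) (+ k) (+ n) ⟨
    f x ℤ.+ (+ 1 ℤ.+ + k) ℤ.* + n      ∎
    where
    open ≡-Reasoning
    step : ∀ x k n → x ℤ.+ (ℤ.1ℤ ℤ.+ k) ℤ.* n ≡ (x ℤ.+ k ℤ.* n) ℤ.+ n
    step = ℤ-solve-∀

  periodic-* : ∀ x K → f (x ℤ.+ K ℤ.* + n) ≡ f x ℤ.+ K ℤ.* + n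
  periodic-* x (+ k)     = periodic-+* x k
  periodic-* x -[1+ k ] = begin
    f y                                  ≡⟨ add-sub (f y) k′ (+ n) ⟩
    (f y ℤ.+ k′ ℤ.* + n) ℤ.- k′ ℤ.* + n  ≡⟨ cong (ℤ._- k′ ℤ.* + n) (periodic-+* y (suc k)) ⟨
    f (y ℤ.+ k′ ℤ.* + n) ℤ.- k′ ℤ.* + n  ≡⟨ cong (λ z → f z ℤ.- k′ ℤ.* + n) (sub-add x k′ (+ n)) ⟩
    f x ℤ.- k′ ℤ.* + n                   ≡⟨ sub≡add-neg (f x) k′ (+ n) ⟩
    f x ℤ.+ -[1+ k ] ℤ.* + n             ∎
    where
    open ≡-Reasoning
    k′ y : ℤ
    k′ = + suc k
    y = x ℤ.+ -[1+ k ] ℤ.* + n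
    add-sub : ∀ x k n → x ≡ (x ℤ.+ k ℤ.* n) ℤ.- k ℤ.* n
    add-sub = ℤ-solve-∀
    sub-add : ∀ x k n → (x ℤ.+ (ℤ.- k) ℤ.* n) ℤ.+ k ℤ.* n ≡ x
    sub-add = ℤ-solve-∀
    sub≡add-neg : ∀ x k n → x ℤ.- k ℤ.* n ≡ x ℤ.+ (ℤ.- k) ℤ.* n
    sub≡add-neg = ℤ-solve-∀

periodic-ext : ∀ {n} .{{_ : NonZero n}} {f g : ℤ → ℤ} → Periodic n f → Periodic n g →
               (∀ (i : Fin n) → f (+ toℕ i) ≡ g (+ toℕ i)) → f ≗ g
periodic-ext {n} {f} {g} f-periodic g-periodic agree z = begin
  f z                        ≡⟨ cong f z≡r+kn ⟩
  f (+ r ℤ.+ k ℤ.* + n)      ≡⟨ periodic-* {f = f} f-periodic (+ r) k ⟩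
  f (+ r) ℤ.+ k ℤ.* + n      ≡⟨ cong (ℤ._+ k ℤ.* + n) agree-r ⟩
  g (+ r) ℤ.+ k ℤ.* + n      ≡⟨ periodic-* {f = g} g-periodic (+ r) k ⟨
  g (+ r ℤ.+ k ℤ.* + n)      ≡⟨ cong g z≡r+kn ⟨
  g z                        ∎
  where
  open ≡-Reasoning
  r : ℕ
  r = z ℤ.%ℕ n
  k : ℤ
  k = z ℤ./ℕ n
  z≡r+kn : z ≡ + r ℤ.+ k ℤ.* + n
  z≡r+kn = ℤ.a≡a%ℕn+[a/ℕn]*n z n
  r<n : r < n
  r<n = ℤ.n%ℕd<d z n
  agree-r : f (+ r) ≡ g (+ r)
  agree-r = subst (λ j → f (+ j) ≡ g (+ j)) (Fin.toℕ-fromℕ< r<n) (agree (Fin.fromℕ< r<n))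

∣d∣≤n⇒0≤d+n : ∀ d {n} → ∣ d ∣ ≤ n → ℤ.0ℤ ℤ.≤ d ℤ.+ + n
∣d∣≤n⇒0≤d+n (+ _)      _   = ℤ.+≤+ z≤n
∣d∣≤n⇒0≤d+n -[1+ k ] k<n = subst (ℤ.0ℤ ℤ.≤_) (sym (ℤ.⊖-≥ k<n)) (ℤ.+≤+ z≤n)

∣x-i∣<n⇒0≤x+n<3n : ∀ {x i n} → ∣ x ℤ.- + i ∣ < n → i < n →
                   ℤ.0ℤ ℤ.≤ x ℤ.+ + n × ∣ x ℤ.+ + n ∣ < 3 * n
∣x-i∣<n⇒0≤x+n<3n {x} {i} {n} ∣x-i∣<n i<n =
  subst (ℤ.0ℤ ℤ.≤_) (sym x+n≡) (∣d∣≤n⇒0≤d+n (x ℤ.- + i) (ℕ.≤-trans (ℕ.<⇒≤ ∣x-i∣<n) (ℕ.m≤n+m n i)))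
  ,
  (begin-strict
    ∣ x ℤ.+ + n ∣                    ≡⟨ cong ∣_∣ x+n≡ ⟩
    ∣ (x ℤ.- + i) ℤ.+ + (i + n) ∣    ≤⟨ ℤ.∣i+j∣≤∣i∣+∣j∣ (x ℤ.- + i) (+ (i + n)) ⟩
    ∣ x ℤ.- + i ∣ + (i + n)          <⟨ ℕ.+-mono-<-≤ ∣x-i∣<n (ℕ.+-monoˡ-≤ n (ℕ.<⇒≤ i<n)) ⟩
    n + (n + n)                      ≡⟨ cong (λ k → n + (n + k)) (ℕ.+-identityʳ n) ⟨
    3 * n                            ∎)
  where
  open ℕ.≤-Reasoning
  split : ∀ x i n → x ℤ.+ n ≡ (x ℤ.- i) ℤ.+ (i ℤ.+ n)
  split = ℤ-solve-∀
  x+n≡ : x ℤ.+ + n ≡ (x ℤ.- + i) ℤ.+ + (i + n)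
  x+n≡ = split x (+ i) (+ n)

j≡i+[1+k]n⇒n≤j : ∀ {n i j} k → + j ≡ + i ℤ.+ + suc k ℤ.* + n → n ≤ j
j≡i+[1+k]n⇒n≤j {n} {i} {j} k eq = subst (n ≤_) (sym j≡) (ℕ.≤-trans (ℕ.m≤m+n n (k * n)) (ℕ.m≤n+m _ i))
  where
  j≡ : j ≡ i + suc k * n
  j≡ = ℤ.+-injective (trans eq (cong (λ z → + i ℤ.+ z) (sym (ℤ.pos-* (suc k) n))))

congruent-in-window⇒≡ : ∀ {n i j} K → i < n → j < n → + j ≡ + i ℤ.+ K ℤ.* + n → i ≡ j
congruent-in-window⇒≡         (+ zero)  _   _   eq = sym (trans (ℤ.+-injective eq) (ℕ.+-identityʳ _))
congruent-in-window⇒≡         (+ suc k) _   j<n eq = contradiction j<n (ℕ.≤⇒≯ (j≡i+[1+k]n⇒n≤j k eq))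
congruent-in-window⇒≡ {n} {i} {j} -[1+ k ] i<n _ eq = contradiction i<n (ℕ.≤⇒≯ (j≡i+[1+k]n⇒n≤j k i≡))
  where
  move : ∀ x K n → x ≡ (x ℤ.+ K ℤ.* n) ℤ.+ (ℤ.- K) ℤ.* n
  move = ℤ-solve-∀
  i≡ : + i ≡ + j ℤ.+ + suc k ℤ.* + n
  i≡ = trans (move (+ i) -[1+ k ] (+ n)) (cong (ℤ._+ + suc k ℤ.* + n) (sym eq))

same-remainder-difference : ∀ a b n l₁ l₂ r →
                            a ℤ.+ n ≡ n ℤ.* l₁ ℤ.+ r → b ℤ.+ n ≡ n ℤ.* l₂ ℤ.+ r →
                            b ≡ a ℤ.+ (l₂ ℤ.- l₁) ℤ.* n
same-remainder-difference a b n l₁ l₂ r a+n≡ b+n≡ = begin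
  b                                                ≡⟨ expand a b n ⟩
  ((b ℤ.+ n) ℤ.- (a ℤ.+ n)) ℤ.+ a                  ≡⟨ cong₂ (λ u v → (u ℤ.- v) ℤ.+ a) b+n≡ a+n≡ ⟩
  ((n ℤ.* l₂ ℤ.+ r) ℤ.- (n ℤ.* l₁ ℤ.+ r)) ℤ.+ a    ≡⟨ collect a n l₁ l₂ r ⟩
  a ℤ.+ (l₂ ℤ.- l₁) ℤ.* n                          ∎
  where
  open ≡-Reasoning
  expand : ∀ a b n → b ≡ ((b ℤ.+ n) ℤ.- (a ℤ.+ n)) ℤ.+ a
  expand = ℤ-solve-∀
  collect : ∀ a n l₁ l₂ r →
            ((n ℤ.* l₂ ℤ.+ r) ℤ.- (n ℤ.* l₁ ℤ.+ r)) ℤ.+ a ≡ a ℤ.+ (l₂ ℤ.- l₁) ℤ.* n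
  collect = ℤ-solve-∀

module BoundedAffine {m : ℕ} {σ : ℤ → ℤ}
                     (affine : IsAffinePerm (suc m) σ) (bounded : IsBounded (suc m) σ) where

  private
    n : ℕ
    n = suc m

  σ-injective : Injective _≡_ _≡_ σ
  σ-injective = proj₁ (IsAffinePerm.bij affine)

  window : Fin n → ℤ
  window i = σ (+ toℕ i)

  window-injective : Injective _≡_ _≡_ window
  window-injective eq = Fin.toℕ-injective (ℤ.+-injective (σ-injective eq))

  window-pattern : Permutation′ n
  window-pattern = Standardisation.standardise window window-injective

  window-pattern-<⇔ : ∀ i j →
                      toℕ (window-pattern ⟨$⟩ʳ i) < toℕ (window-pattern ⟨$⟩ʳ j) ⇔ window i ℤ.< window j
  window-pattern-<⇔ = Standardisation.standardise-<⇔ window window-injective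

  window-pattern-avoids : ∀ {k} {τ : Permutation′ k} → ¬ AffContains σ τ → Avoids window-pattern τ
  window-pattern-avoids ¬contains (idx , increasing , order) = ¬contains
    ( (λ a → + toℕ (idx a))
    , (λ a b a<b → ℤ.+<+ (increasing a b a<b))
    , (λ a b → ⇔.trans (⇔.sym (window-pattern-<⇔ (idx a) (idx b))) (order a b)))

  window-bounds : ∀ i → ℤ.0ℤ ℤ.≤ window i ℤ.+ + n × ∣ window i ℤ.+ + n ∣ < 3 * n
  window-bounds i = ∣x-i∣<n⇒0≤x+n<3n {x = window i} (bounded (+ toℕ i)) (Fin.toℕ<n i)

  shifted : Fin n → Fin (3 * n)
  shifted i = Fin.fromℕ< (proj₂ (window-bounds i))

  +shifted : ∀ i → + toℕ (shifted i) ≡ window i ℤ.+ + n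
  +shifted i = trans (cong +_ (Fin.toℕ-fromℕ< _)) (ℤ.0≤i⇒+∣i∣≡i (proj₁ (window-bounds i)))

  level : Fin n → Fin 3
  level = Fin.quotient n ∘ shifted

  residue : Fin n → Fin n
  residue = Fin.remainder {3} n ∘ shifted

  toℕ-shifted : ∀ i → toℕ (shifted i) ≡ n * toℕ (level i) + toℕ (residue i)
  toℕ-shifted i = trans (cong toℕ (sym (Fin.combine-remQuot {3} n (shifted i))))
                        (Fin.toℕ-combine (level i) (residue i))

  window+n≡ : ∀ i → window i ℤ.+ + n ≡ + n ℤ.* + toℕ (level i) ℤ.+ + toℕ (residue i)
  window+n≡ i = begin
    window i ℤ.+ + n                                  ≡⟨ +shifted i ⟨
    + toℕ (shifted i)                                 ≡⟨ cong +_ (toℕ-shifted i) ⟩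
    + (n * toℕ (level i) + toℕ (residue i))           ≡⟨ ℤ.pos-+ (n * toℕ (level i)) _ ⟩
    + (n * toℕ (level i)) ℤ.+ + toℕ (residue i)       ≡⟨ cong (ℤ._+ + toℕ (residue i)) (ℤ.pos-* n _) ⟩
    + n ℤ.* + toℕ (level i) ℤ.+ + toℕ (residue i)     ∎
    where open ≡-Reasoning

  -- Equal residues make σ(j) - σ(i) a multiple of n, so by periodicity and injectivity of σ
  -- also j - i, which forces i = j inside the window.
  residue-injective : Injective _≡_ _≡_ residue
  residue-injective {i} {j} same-residue =
    Fin.toℕ-injective (congruent-in-window⇒≡ k (Fin.toℕ<n i) (Fin.toℕ<n j) (σ-injective σj≡))
    where
    k : ℤ
    k = + toℕ (level j) ℤ.- + toℕ (level i)
    σj≡ : σ (+ toℕ j) ≡ σ (+ toℕ i ℤ.+ k ℤ.* + n)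
    window-j+n≡ : window j ℤ.+ + n ≡ + n ℤ.* + toℕ (level j) ℤ.+ + toℕ (residue i)
    window-j+n≡ rewrite same-residue = window+n≡ j
    σj≡ = trans (same-remainder-difference (window i) (window j) (+ n) (+ toℕ (level i)) (+ toℕ (level j))
                                           (+ toℕ (residue i)) (window+n≡ i) window-j+n≡)
                (sym (periodic-* {f = σ} (IsAffinePerm.periodic affine) (+ toℕ i) k))

  residues : Permutation′ n
  residues = injective⇒permutation residue residue-injective

  -- σ takes exactly one window value in each residue class mod n; the code records its level.
  code : Fin n → Fin 3
  code r = level (residues ⟨$⟩ˡ r)

  shifted≡combine : ∀ i → shifted i ≡ Fin.combine (code (residue i)) (residue i)
  shifted≡combine i = begin
    shifted i                                   ≡⟨ Fin.combine-remQuot {3} n (shifted i) ⟨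
    Fin.combine (level i) (residue i)           ≡⟨ cong (λ j → Fin.combine (level j) (residue i))
                                                         (inverseˡ residues) ⟨
    Fin.combine (code (residue i)) (residue i)  ∎
    where open ≡-Reasoning

module _ {m} {σ σ′ : ℤ → ℤ}
         (affine : IsAffinePerm (suc m) σ) (bounded : IsBounded (suc m) σ)
         (affine′ : IsAffinePerm (suc m) σ′) (bounded′ : IsBounded (suc m) σ′) where
  private
    module W  = BoundedAffine affine bounded
    module W′ = BoundedAffine affine′ bounded′

  same-code⇒window⊆ : W.code ≗ W′.code → ∀ i → ∃ λ j → W.window i ≡ W′.window j
  same-code⇒window⊆ same-code i = j , ∙-cancelʳ (+ suc m) _ _ (begin
    W.window i ℤ.+ + suc m   ≡⟨ W.+shifted i ⟨
    + toℕ (W.shifted i)      ≡⟨ cong (+_ ∘ toℕ) shifted-i≡shifted-j ⟩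
    + toℕ (W′.shifted j)     ≡⟨ W′.+shifted j ⟩
    W′.window j ℤ.+ + suc m  ∎)
    where
    open ≡-Reasoning
    r j : Fin (suc m)
    r = W.residue i
    j = W′.residues ⟨$⟩ˡ r
    shifted-i≡shifted-j : W.shifted i ≡ W′.shifted j
    shifted-i≡shifted-j = begin
      W.shifted i                                       ≡⟨ W.shifted≡combine i ⟩
      Fin.combine (W.code r) r                          ≡⟨ cong (λ c → Fin.combine c r) (same-code r) ⟩
      Fin.combine (W′.code r) r                         ≡⟨ cong (λ s → Fin.combine (W′.code s) s)
                                                               (inverseʳ W′.residues) ⟨
      Fin.combine (W′.code (W′.residue j)) (W′.residue j) ≡⟨ W′.shifted≡combine j ⟨
      W′.shifted j                                      ∎

window-pattern-code-injective :
  ∀ {m} {σ σ′ : ℤ → ℤ} (affine : IsAffinePerm (suc m) σ) (bounded : IsBounded (suc m) σ)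
  (affine′ : IsAffinePerm (suc m) σ′) (bounded′ : IsBounded (suc m) σ′) →
  let module W = BoundedAffine affine bounded; module W′ = BoundedAffine affine′ bounded′ in
  W.window-pattern ≈ W′.window-pattern → W.code ≗ W′.code → σ ≗ σ′
window-pattern-code-injective affine bounded affine′ bounded′ same-pattern same-code =
  periodic-ext (IsAffinePerm.periodic affine) (IsAffinePerm.periodic affine′)
    (same-image-pattern⇒≗ same-order
      (same-code⇒window⊆ affine bounded affine′ bounded′ same-code)
      (same-code⇒window⊆ affine′ bounded′ affine bounded (sym ∘ same-code)))
  where
  module W  = BoundedAffine affine bounded
  module W′ = BoundedAffine affine′ bounded′
  same-order : ∀ i j → W.window i ℤ.< W.window j ⇔ W′.window i ℤ.< W′.window j
  same-order i j = ⇔.trans (⇔.sym (W.window-pattern-<⇔ i j))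
    (subst₂ (λ a b → toℕ a < toℕ b ⇔ W′.window i ℤ.< W′.window j)
            (sym (same-pattern i)) (sym (same-pattern j)) (W′.window-pattern-<⇔ i j))

funToFin-injective : ∀ {m n} {f g : Fin m → Fin n} → Fin.funToFin f ≡ Fin.funToFin g → f ≗ g
funToFin-injective {f = f} {g} eq i = begin
  f i                              ≡⟨ Fin.finToFun-funToFin f i ⟨
  Fin.finToFun (Fin.funToFin f) i  ≡⟨ cong (λ t → Fin.finToFun t i) eq ⟩
  Fin.finToFun (Fin.funToFin g) i  ≡⟨ Fin.finToFun-funToFin g i ⟩
  g i                              ∎
  where open ≡-Reasoning

CardS≤⇒CardAff≤ : ∀ {m k q p} {τ : Permutation′ k} →
                  CardS≤ (suc m) τ q p → CardAff≤ (suc m) τ q (3 ^ suc m * p)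
CardS≤⇒CardAff≤ {m} {τ = τ} bound = CardBound-map encode encode-avoids encode-reflects (CardBound-× bound)
  where
  encode : ∀ {σ} → BddAffAvoider (suc m) τ σ → Permutation′ (suc m) × Fin (3 ^ suc m)
  encode (affine , bounded , _) = W.window-pattern , Fin.funToFin W.code
    where module W = BoundedAffine affine bounded
  encode-avoids : ∀ {σ} (a : BddAffAvoider (suc m) τ σ) → Avoids (proj₁ (encode a)) τ
  encode-avoids (affine , bounded , ¬contains) =
    BoundedAffine.window-pattern-avoids affine bounded {τ = τ} ¬contains
  encode-reflects : ∀ {σ σ′} (a : BddAffAvoider (suc m) τ σ) (a′ : BddAffAvoider (suc m) τ σ′) →
                    Pointwise _≈_ _≡_ (encode a) (encode a′) → σ ≗ σ′
  encode-reflects (affine , bounded , _) (affine′ , bounded′ , _) (same-pattern , same-code) =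
    window-pattern-code-injective affine bounded affine′ bounded′ same-pattern (funToFin-injective same-code)

^-distribʳ-* : ∀ a b n → (a * b) ^ n ≡ a ^ n * b ^ n
^-distribʳ-* a b zero    = refl
^-distribʳ-* a b (suc n) =
  trans (cong (a * b *_) (^-distribʳ-* a b n)) (ℕ.[m*n]*[o*p]≡[m*o]*[n*p] a b (a ^ n) (b ^ n))

rescale : ∀ {L} c p q r s n .{{_ : NonZero q}} →
          c * p * s ≤ r * q → L * q ^ n ≤ c ^ n * p ^ n → L * s ^ n ≤ r ^ n
rescale {L} c p q r s n cps≤rq bound = ℕ.*-cancelʳ-≤ (L * s ^ n) (r ^ n) (q ^ n) {{ℕ.m^n≢0 q n}} (begin
  L * s ^ n * q ^ n        ≡⟨ swap L (s ^ n) (q ^ n) ⟩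
  L * q ^ n * s ^ n        ≤⟨ ℕ.*-monoˡ-≤ (s ^ n) bound ⟩
  c ^ n * p ^ n * s ^ n    ≡⟨ cong (_* s ^ n) (^-distribʳ-* c p n) ⟨
  (c * p) ^ n * s ^ n      ≡⟨ ^-distribʳ-* (c * p) s n ⟨
  (c * p * s) ^ n          ≤⟨ ℕ.^-monoˡ-≤ n cps≤rq ⟩
  (r * q) ^ n              ≡⟨ ^-distribʳ-* r q n ⟩
  r ^ n * q ^ n            ∎)
  where
  open ℕ.≤-Reasoning
  swap : ∀ a b c → a * b * c ≡ a * c * b
  swap = ℕ-solve-∀

proposition1p8 : ∀ {k} (τ : Permutation′ k) (p q r s : ℕ) → 1 ≤ q → 1 ≤ s → EventuallyS≤ τ p q → 3 * p * s < r * q → EventuallyAff≤ τ r s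
proposition1p8 τ p q r s 1≤q _ (N , eventually) 3ps<rq = N , λ n N≤n → scale n (eventually n N≤n)
  where
  scale : ∀ n → CardS≤ n τ (q ^ n) (p ^ n) → CardAff≤ n τ (s ^ n) (r ^ n)
  scale zero    _     = empty⇒CardBound λ _ (_ , bounded , _) → ℕ.n≮0 (bounded (+ 0))
  scale (suc m) bound xs pxs distinct =
    rescale {length xs} 3 p q r s (suc m) {{>-nonZero 1≤q}} (ℕ.<⇒≤ 3ps<rq)
      (CardS≤⇒CardAff≤ {τ = τ} bound xs pxs distinct)
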